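{- Let $G$ be a finite simple graph with $\delta(G)\geq 1$ and let $M(G)$ be its Mycielskian. Then $G$ belongs to Class 2 if and only if $\chi_d^t(M(G))=\chi_d^t(G)+2$.
   Context: All graphs are finite, undirected and simple. A total dominator coloring (TDC) of $G$ is a proper coloring of $G$ in which every vertex of $G$ is adjacent to every vertex of some color class; $\chi_d^t(G)$ is the minimum number of color classes in a TDC of $G$, and a $\chi_d^t$-coloring is a TDC with $\chi_d^t(G)$ colors. For a TDC $f=(V_1,\dots,V_\ell)$ (with $V_i$ the color classes), write $v\succ V_i$ if $v$ is adjacent to all vertices of $V_i$. A vertex $v$ is a private neighbor of $V_i$ with respect to $f$ if $v\succ V_i$ and $v\not\succ V_j$ for all $j\neq i$; the set of these is $pn_G(V_i;f)$. $G$ belongs to Class 1 if it has a $\chi_d^t$-coloring $f=(V_1,\dots,V_\ell)$ with $pn_G(V_i;f)=\emptyset$ for some $i$, and to Class 2 otherwise. If $V(G)=\{v_1,\dots,v_n\}$, the Mycielskian $M(G)$ has vertex set $V(G)\cup\{u_1,\dots,u_n\}\cup\{w\}$ and edge set $E(G)\cup\{u_iv_j : v_iv_j\in E(G)\}\cup\{u_iw : 1\le i\le n\}$. -}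

module Defs where

open import Data.Nat using (ℕ; _≤_)
open import Data.Fin using (Fin)
open import Data.Product using (Σ; ∃; ∃-syntax; _×_; _,_)
open import Data.Unit using (⊤)
open import Data.Empty using (⊥)
open import Relation.Nullary using (¬_; Dec)
open import Relation.Binary.PropositionalEquality using (_≡_; _≢_)

record Graph (V : Set) : Set₁ where
  field
    Adj    : V → V → Set
    sym    : ∀ {u v} → Adj u v → Adj v u
    irrefl : ∀ {v} → ¬ Adj v v
    dec    : ∀ u v → Dec (Adj u v)
open Graph public

FinGraph : ℕ → Set₁
FinGraph n = Graph (Fin n)

MinDegAtLeast1 : ∀ {V} → Graph V → Set
MinDegAtLeast1 {V} G = ∀ (v : V) → ∃[ u ] Adj G v u

-- Vertices of the Mycielskian: v_i (orig i), u_i (shadow i), w (root).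
data MV (V : Set) : Set where
  orig   : V → MV V
  shadow : V → MV V
  root   : MV V

MAdj : ∀ {V} → Graph V → MV V → MV V → Set
MAdj G (orig i)   (orig j)   = Adj G i j
MAdj G (orig i)   (shadow j) = Adj G i j
MAdj G (shadow i) (orig j)   = Adj G i j
MAdj G (shadow i) (shadow j) = ⊥
MAdj G (shadow i) root       = ⊤
MAdj G root       (shadow j) = ⊤
MAdj G (orig i)   root       = ⊥
MAdj G root       (orig j)   = ⊥
MAdj G root       root       = ⊥

private
  msym : ∀ {V} (G : Graph V) {x y} → MAdj G x y → MAdj G y x
  msym G {orig i}   {orig j}   a = sym G a
  msym G {orig i}   {shadow j} a = sym G a
  msym G {shadow i} {orig j}   a = sym G a
  msym G {shadow i} {root}     a = a
  msym G {root}     {shadow j} a = a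

  mirr : ∀ {V} (G : Graph V) {x} → ¬ MAdj G x x
  mirr G {orig i} a = irrefl G a
  mirr G {shadow i} ()
  mirr G {root} ()

  mdec : ∀ {V} (G : Graph V) x y → Dec (MAdj G x y)
  mdec G (orig i)   (orig j)   = dec G i j
  mdec G (orig i)   (shadow j) = dec G i j
  mdec G (shadow i) (orig j)   = dec G i j
  mdec G (shadow i) (shadow j) = Relation.Nullary.no (λ ())
  mdec G (shadow i) root       = Relation.Nullary.yes _
  mdec G root       (shadow j) = Relation.Nullary.yes _
  mdec G (orig i)   root       = Relation.Nullary.no (λ ())
  mdec G root       (orig j)   = Relation.Nullary.no (λ ())
  mdec G root       root       = Relation.Nullary.no (λ ())

Mycielskian : ∀ {V} → Graph V → Graph (MV V)
Mycielskian G = record { Adj = MAdj G ; sym = λ {x} {y} → msym G {x} {y} ; irrefl = λ {x} → mirr G {x} ; dec = mdec G }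

Dominates : ∀ {V k} → Graph V → (V → Fin k) → V → Fin k → Set
Dominates {V} G f v i = ∀ (u : V) → f u ≡ i → Adj G v u

IsTDC : ∀ {V} → Graph V → (k : ℕ) → (V → Fin k) → Set
IsTDC {V} G k f =
  (∀ (i : Fin k) → ∃[ v ] f v ≡ i) ×
  (∀ (u v : V) → Adj G u v → f u ≢ f v) ×
  (∀ (v : V) → ∃[ i ] Dominates G f v i)

HasTDC : ∀ {V} → Graph V → ℕ → Set
HasTDC {V} G k = ∃[ f ] IsTDC {V} G k f

IsTDCNumber : ∀ {V} → Graph V → ℕ → Set
IsTDCNumber G k = HasTDC G k × (∀ m → HasTDC G m → k ≤ m)

PrivNbr : ∀ {V k} → Graph V → (V → Fin k) → Fin k → V → Set
PrivNbr G f i v = Dominates G f v i × (∀ j → j ≢ i → ¬ Dominates G f v j)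

Class1 : ∀ {V} → Graph V → Set
Class1 {V} G = ∃[ k ] (IsTDCNumber G k ×
  (∃[ f ] (IsTDC G k f × ∃[ i ] (∀ (v : V) → ¬ PrivNbr G f i v))))

Class2 : ∀ {V} → Graph V → Set
Class2 G = ¬ Class1 G

-- A χ_d^t-colouring of G extends to M(G) with two new colours, one for all the
-- shadows u_i and one for w; if some class V_i has no private neighbour, one new
-- colour suffices, since w may then take colour i. Conversely, let g be a TDC of
-- M(G) and B the class dominated by w, which consists of shadows only. Recolour G
-- so that the colour g(w) disappears: if some v_i has colour g(w), give all such
-- vertices colour B; otherwise let one shadow of each class free of the v_i lend
-- its colour to its original. The result is a proper colouring of G missing g(w)
-- in which every vertex dominates a nonempty class other than one fixed class.
-- Dropping g(w) and the empty classes gives χ_d^t(G) ≤ χ_d^t(M(G)) − 1, and at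
-- equality the fixed class has no private neighbour, so G is in Class 1.
module Submission where

open import Defs
open import Data.Bool using (if_then_else_)
open import Data.Nat as ℕ using (ℕ; zero; suc; _+_; _<_; z≤n; s≤s)
open import Data.Nat.Properties as ℕ using (≤-refl; ≤-trans; <⇒≱; ≤∧≢⇒<; ≤-pred; +-comm)
open import Data.Fin as Fin using (Fin; zero; suc; punchOut; _≟_)
open import Data.Fin.Properties using (punchOut-injective; suc-injective; any?; all?; ¬∀⟶∃¬; ≤-antisym)
open import Data.Product using (∃; ∃-syntax; _×_; _,_; proj₁; proj₂)
open import Data.Sum using (_⊎_; inj₁; inj₂)
open import Data.Empty using (⊥-elim)
open import Data.Unit using (tt)
open import Function using (_∘_)
open import Function.Bundles using (_⇔_; mk⇔)
open import Relation.Nullary using (¬_; Dec; yes; no; does; ¬?; _×-dec_; _→-dec_)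
open import Relation.Unary using (Pred; Decidable)
open import Relation.Binary.PropositionalEquality as ≡ using (_≡_; _≢_; refl; trans; subst)

Proper : ∀ {V m} → Graph V → (V → Fin m) → Set
Proper G h = ∀ u v → Adj G u v → h u ≢ h v

Occurs : ∀ {V m} → (V → Fin m) → Fin m → Set
Occurs h i = ∃[ u ] h u ≡ i

record IsWeakTDC {V} (G : Graph V) (m : ℕ) (h : V → Fin m) : Set where
  constructor _,_
  field
    proper     : Proper G h
    dominating : ∀ v → ∃[ i ] Occurs h i × Dominates G h v i

Redundant : ∀ {V m} → Graph V → (V → Fin m) → Fin m → Set
Redundant G h c = ∀ v → ∃[ d ] d ≢ c × Occurs h d × Dominates G h v d

redundant⇒dominating : ∀ {V m} {G : Graph V} {h : V → Fin m} {c} →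
  Redundant G h c → ∀ v → ∃[ i ] Occurs h i × Dominates G h v i
redundant⇒dominating red v with red v
... | d , _ , occ , dom = d , occ , dom

redundant⇒noPrivNbr : ∀ {V m} {G : Graph V} {h : V → Fin m} {c} →
  Redundant G h c → ∀ v → ¬ PrivNbr G h c v
redundant⇒noPrivNbr red v (_ , private′) with red v
... | d , d≢c , _ , dom = private′ d d≢c dom

dominates? : ∀ {n m} (G : FinGraph n) (h : Fin n → Fin m) v i → Dec (Dominates G h v i)
dominates? G h v i = all? (λ u → (h u ≟ i) →-dec dec G v u)

noPrivNbr⇒redundant : ∀ {n k} {G : FinGraph n} {f : Fin n → Fin k} {c} →
  IsTDC G k f → (∀ v → ¬ PrivNbr G f c v) → Redundant G f c
noPrivNbr⇒redundant {G = G} {f} {c} (onto , _ , dominating) noPN v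
  with any? (λ d → ¬? (d ≟ c) ×-dec dominates? G f v d)
... | yes (d , d≢c , dom) = d , d≢c , onto d , dom
... | no none with dominating v
...   | d , dom with d ≟ c
...     | yes refl = ⊥-elim (noPN v (dom , λ d′ d′≢c dom′ → none (d′ , d′≢c , dom′)))
...     | no d≢c = ⊥-elim (none (d , d≢c , dom))

weakTDC-onto⇒TDC : ∀ {V m} {G : Graph V} {h : V → Fin m} →
  IsWeakTDC G m h → (∀ i → Occurs h i) → IsTDC G m h
weakTDC-onto⇒TDC (proper , dominating) onto =
  onto , proper , λ v → proj₁ (dominating v) , proj₂ (proj₂ (dominating v))

onto⊎unused : ∀ {n m} (h : Fin n → Fin m) → (∀ i → Occurs h i) ⊎ (∃[ a ] ∀ u → a ≢ h u)
onto⊎unused h with all? (λ i → any? (λ u → h u ≟ i))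
... | yes onto = inj₁ onto
... | no ¬onto with ¬∀⟶∃¬ _ _ (λ i → any? (λ u → h u ≟ i)) ¬onto
...   | a , unused = inj₂ (a , λ u a≡hu → unused (u , ≡.sym a≡hu))

module RemoveColour {V m} {G : Graph V} (h : V → Fin (suc m)) {a : Fin (suc m)}
                    (a∉h : ∀ u → a ≢ h u) where

  h⁻ : V → Fin m
  h⁻ u = punchOut (a∉h u)

  occurs⇒≢ : ∀ {d} → Occurs h d → a ≢ d
  occurs⇒≢ (u , hu≡d) a≡d = a∉h u (trans a≡d (≡.sym hu≡d))

  proper : Proper G h → Proper G h⁻
  proper proper′ u v adj eq = proper′ u v adj (punchOut-injective (a∉h u) (a∉h v) eq)

  occurs : ∀ {d} (occ : Occurs h d) → Occurs h⁻ (punchOut (occurs⇒≢ occ))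
  occurs occ@(u , refl) = u , refl

  dominates : ∀ {v d} (a≢d : a ≢ d) → Dominates G h v d → Dominates G h⁻ v (punchOut a≢d)
  dominates a≢d dom u eq = dom u (punchOut-injective (a∉h u) a≢d eq)

  redundant : ∀ {c} (a≢c : a ≢ c) → Redundant G h c → Redundant G h⁻ (punchOut a≢c)
  redundant a≢c red v with red v
  ... | d , d≢c , occ , dom =
    punchOut (occurs⇒≢ occ) , d≢c ∘ punchOut-injective _ a≢c , occurs occ , dominates _ dom

  weakTDC : IsWeakTDC G (suc m) h → IsWeakTDC G m h⁻
  weakTDC (proper′ , dominating) = proper proper′ , λ v → shrink (dominating v)
    where
    shrink : ∀ {v} → ∃[ i ] Occurs h i × Dominates G h v i → ∃[ i ] Occurs h⁻ i × Dominates G h⁻ v i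
    shrink (_ , occ , dom) = _ , occurs occ , dominates _ dom

mutual
  weakTDC⇒TDC : ∀ {n m} {G : FinGraph n} {h : Fin n → Fin m} →
    IsWeakTDC G m h → ∃[ m′ ] m′ ℕ.≤ m × HasTDC G m′
  weakTDC⇒TDC {h = h} weak with onto⊎unused h
  ... | inj₁ onto = _ , ≤-refl , h , weakTDC-onto⇒TDC weak onto
  ... | inj₂ (_ , a∉h) with unused⇒smallerTDC weak a∉h
  ...   | m′ , m′<m , tdc = m′ , ℕ.<⇒≤ m′<m , tdc

  unused⇒smallerTDC : ∀ {n m} {G : FinGraph n} {h : Fin n → Fin m} {a} →
    IsWeakTDC G m h → (∀ u → a ≢ h u) → ∃[ m′ ] m′ < m × HasTDC G m′
  unused⇒smallerTDC {m = zero} {a = ()}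
  unused⇒smallerTDC {m = suc m} {h = h} weak a∉h
    with weakTDC⇒TDC (RemoveColour.weakTDC h a∉h weak)
  ... | m′ , m′≤m , tdc = m′ , s≤s m′≤m , tdc

minimal-weakTDC⇒TDC : ∀ {n k} {G : FinGraph n} {h : Fin n → Fin k} →
  (∀ m → HasTDC G m → k ℕ.≤ m) → IsWeakTDC G k h → IsTDC G k h
minimal-weakTDC⇒TDC {h = h} minimal weak with onto⊎unused h
... | inj₁ onto = weakTDC-onto⇒TDC weak onto
... | inj₂ (_ , a∉h) with unused⇒smallerTDC weak a∉h
...   | m′ , m′<k , tdc = ⊥-elim (<⇒≱ m′<k (minimal m′ tdc))

record SpareColouring {n} (G : FinGraph n) (ℓ : ℕ) : Set where
  field
    colour        : Fin n → Fin ℓ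
    proper        : Proper G colour
    missing       : Fin ℓ
    missing∉      : ∀ u → missing ≢ colour u
    spare         : Fin ℓ
    missing≢spare : missing ≢ spare
    redundant     : Redundant G colour spare

  weakTDC : IsWeakTDC G ℓ colour
  weakTDC = proper , redundant⇒dominating {G = G} redundant

spareColouring⇒smallerTDC : ∀ {n ℓ} {G : FinGraph n} →
  SpareColouring G ℓ → ∃[ m ] m < ℓ × HasTDC G m
spareColouring⇒smallerTDC s = unused⇒smallerTDC weakTDC missing∉
  where open SpareColouring s

spareColouring⇒Class1 : ∀ {n k} {G : FinGraph n} →
  IsTDCNumber G k → SpareColouring G (suc k) → Class1 G
spareColouring⇒Class1 {k = k} {G} χ@(_ , minimal) s =
  k , χ , h⁻ , minimal-weakTDC⇒TDC minimal (weakTDC weakTDC′) ,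
  punchOut missing≢spare , redundant⇒noPrivNbr {G = G} (redundant missing≢spare redundant′)
  where
  open SpareColouring s renaming (weakTDC to weakTDC′; redundant to redundant′)
  open RemoveColour {G = G} colour missing∉

-- Upper bounds for χ_d^t(M(G))

TDC⇒mycielskianTDC : ∀ {n k} {G : FinGraph n} {f : Fin n → Fin k} →
  IsTDC G k f → Fin n → HasTDC (Mycielskian G) (suc (suc k))
TDC⇒mycielskianTDC {n} {k} {G} {f} (onto , proper , dominating) v₀ = g , onto′ , proper′ , dominating′
  where
  g : MV (Fin n) → Fin (suc (suc k))
  g (orig v)   = suc (suc (f v))
  g (shadow v) = zero
  g root       = suc zero

  onto′ : ∀ i → Occurs g i
  onto′ zero          = shadow v₀ , refl
  onto′ (suc zero)    = root , refl
  onto′ (suc (suc i)) with onto i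
  ... | v , refl = orig v , refl

  proper′ : Proper (Mycielskian G) g
  proper′ (orig u) (orig v) adj eq = proper u v adj (suc-injective (suc-injective eq))
  proper′ (orig u) (shadow v) _ ()
  proper′ (shadow u) (orig v) _ ()
  proper′ (shadow u) root _ ()
  proper′ root (shadow v) _ ()

  dominating′ : ∀ x → ∃[ i ] Dominates (Mycielskian G) g x i
  dominating′ (orig v) with dominating v
  ... | i , dom = suc (suc i) , λ { (orig u) eq → dom u (suc-injective (suc-injective eq)) }
  dominating′ (shadow v) = suc zero , λ { root _ → tt }
  dominating′ root       = zero , λ { (shadow u) _ → tt }

redundantTDC⇒mycielskianTDC : ∀ {n k} {G : FinGraph n} {f : Fin n → Fin k} {c} →
  IsTDC G k f → Redundant G f c → HasTDC (Mycielskian G) (suc k)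
redundantTDC⇒mycielskianTDC {n} {k} {G} {f} {c} (onto , proper , _) red =
  g , onto′ , proper′ , dominating′
  where
  g : MV (Fin n) → Fin (suc k)
  g (orig v)   = suc (f v)
  g (shadow v) = zero
  g root       = suc c

  onto′ : ∀ i → Occurs g i
  onto′ zero = shadow (proj₁ (onto c)) , refl
  onto′ (suc i) with onto i
  ... | v , refl = orig v , refl

  proper′ : Proper (Mycielskian G) g
  proper′ (orig u) (orig v) adj eq = proper u v adj (suc-injective eq)
  proper′ (orig u) (shadow v) _ ()
  proper′ (shadow u) (orig v) _ ()
  proper′ (shadow u) root _ ()
  proper′ root (shadow v) _ ()

  dominating′ : ∀ x → ∃[ i ] Dominates (Mycielskian G) g x i
  dominating′ (orig v) with red v
  ... | d , d≢c , _ , dom = suc d , λ { (orig u) eq → dom u (suc-injective eq)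
                                      ; root eq → d≢c (≡.sym (suc-injective eq)) }
  dominating′ (shadow v) with red v
  ... | d , _ , _ , dom = suc d , λ { (orig u) eq → dom u (suc-injective eq) ; root _ → tt }
  dominating′ root = zero , λ { (shadow u) _ → tt }

-- Lower bound for χ_d^t(M(G))

least : ∀ {n p} {P : Pred (Fin n) p} → Decidable P → ∃ P → ∃[ i ] P i × (∀ j → P j → i Fin.≤ j)
least P? (zero , p₀) = zero , p₀ , λ _ _ → z≤n
least P? (suc i , pᵢ) with P? zero
... | yes p₀ = zero , p₀ , λ _ _ → z≤n
... | no ¬p₀ with least (P? ∘ suc) (i , pᵢ)
...   | j , pⱼ , j≤ = suc j , pⱼ , λ { zero p₀ → ⊥-elim (¬p₀ p₀) ; (suc k) pₖ → s≤s (j≤ k pₖ) }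

if-dec-cases : ∀ {A P : Set} (P? : Dec P) (x y : A) →
  (P × (if does P? then x else y) ≡ x) ⊎ (¬ P × (if does P? then x else y) ≡ y)
if-dec-cases (yes p) x y = inj₁ (p , refl)
if-dec-cases (no ¬p) x y = inj₂ (¬p , refl)

module FromMycielskianTDC {n ℓ} (G : FinGraph n) (g : MV (Fin n) → Fin ℓ)
                          (tdc : IsTDC (Mycielskian G) ℓ g) where

  private
    onto : ∀ i → Occurs g i
    onto = proj₁ tdc

    proper : Proper (Mycielskian G) g
    proper = proj₁ (proj₂ tdc)

    dominating : ∀ x → ∃[ i ] Dominates (Mycielskian G) g x i
    dominating = proj₂ (proj₂ tdc)

  p q : Fin n → Fin ℓ
  p = g ∘ orig
  q = g ∘ shadow

  a b : Fin ℓ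
  a = g root
  b = proj₁ (dominating root)

  p≢b : ∀ m → p m ≢ b
  p≢b m = proj₂ (dominating root) (orig m)

  a≢b : a ≢ b
  a≢b = proj₂ (dominating root) root

  q≢a : ∀ m → q m ≢ a
  q≢a m = proper (shadow m) root tt

  b-shadow : ∃[ m ] q m ≡ b
  b-shadow with onto b
  ... | orig m , pm≡b   = ⊥-elim (p≢b m pm≡b)
  ... | shadow m , qm≡b = m , qm≡b
  ... | root , a≡b      = ⊥-elim (a≢b a≡b)

  vertex : Fin n
  vertex = proj₁ b-shadow

  classMember : ∀ e → e ≢ a → (∃[ m ] p m ≡ e) ⊎ (∃[ m ] q m ≡ e)
  classMember e e≢a with onto e
  ... | orig m , pm≡e   = inj₁ (m , pm≡e)
  ... | shadow m , qm≡e = inj₂ (m , qm≡e)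
  ... | root , a≡e      = ⊥-elim (e≢a (≡.sym a≡e))

  module SomeOriginalColouredA (l₀ : Fin n) (pl₀≡a : p l₀ ≡ a) where

    h : Fin n → Fin ℓ
    h l = if does (p l ≟ a) then b else p l

    h-cases : ∀ l → (p l ≡ a × h l ≡ b) ⊎ (p l ≢ a × h l ≡ p l)
    h-cases l = if-dec-cases (p l ≟ a) b (p l)

    a∉h : ∀ u → a ≢ h u
    a∉h u with h-cases u
    ... | inj₁ (_ , hu≡b)     = λ a≡hu → a≢b (trans a≡hu hu≡b)
    ... | inj₂ (pu≢a , hu≡pu) = λ a≡hu → pu≢a (≡.sym (trans a≡hu hu≡pu))

    h≡⇒p≡ : ∀ {u d} → h u ≡ d → (p u ≡ a × d ≡ b) ⊎ p u ≡ d
    h≡⇒p≡ {u} hu≡d with h-cases u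
    ... | inj₁ (pu≡a , hu≡b) = inj₁ (pu≡a , trans (≡.sym hu≡d) hu≡b)
    ... | inj₂ (_ , hu≡pu)   = inj₂ (trans (≡.sym hu≡pu) hu≡d)

    proper-h : Proper G h
    proper-h u v adj hu≡hv with h≡⇒p≡ {u} refl | h≡⇒p≡ {v} refl
    ... | inj₁ (pu≡a , _) | inj₁ (pv≡a , _) = proper (orig u) (orig v) adj (trans pu≡a (≡.sym pv≡a))
    ... | inj₁ (_ , hu≡b) | inj₂ pv≡hv = p≢b v (trans pv≡hv (trans (≡.sym hu≡hv) hu≡b))
    ... | inj₂ pu≡hu | inj₁ (_ , hv≡b) = p≢b u (trans pu≡hu (trans hu≡hv hv≡b))
    ... | inj₂ pu≡hu | inj₂ pv≡hv = proper (orig u) (orig v) adj (trans pu≡hu (trans hu≡hv (≡.sym pv≡hv)))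

    occurs-b : Occurs h b
    occurs-b with h≡⇒p≡ {l₀} refl
    ... | inj₁ (_ , hl₀≡b) = l₀ , hl₀≡b
    ... | inj₂ pl₀≡hl₀     = ⊥-elim (a∉h l₀ (trans (≡.sym pl₀≡a) pl₀≡hl₀))

    dominates-b : ∀ {v} → (∀ u → p u ≡ a → Adj G v u) → Dominates G h v b
    dominates-b adjA u hu≡b with h≡⇒p≡ hu≡b
    ... | inj₁ (pu≡a , _) = adjA u pu≡a
    ... | inj₂ pu≡b       = ⊥-elim (p≢b u pu≡b)

    shadowFree : ∀ {v e} → e ≢ a → (∀ m → q m ≢ e) → (∀ u → p u ≡ e → Adj G v u) →
                 Occurs h e × Dominates G h v e
    shadowFree {e = e} e≢a noShadow adjE = occurs-e , dominates-e
      where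
      e≢b : e ≢ b
      e≢b e≡b = noShadow (proj₁ b-shadow) (trans (proj₂ b-shadow) (≡.sym e≡b))

      occurs-e : Occurs h e
      occurs-e with classMember e e≢a
      ... | inj₂ (m , qm≡e) = ⊥-elim (noShadow m qm≡e)
      ... | inj₁ (m , pm≡e) with h≡⇒p≡ {m} refl
      ...   | inj₁ (pm≡a , _) = ⊥-elim (e≢a (trans (≡.sym pm≡e) pm≡a))
      ...   | inj₂ pm≡hm      = m , trans (≡.sym pm≡hm) pm≡e

      dominates-e : Dominates G h _ e
      dominates-e u hu≡e with h≡⇒p≡ hu≡e
      ... | inj₁ (_ , e≡b) = ⊥-elim (e≢b e≡b)
      ... | inj₂ pu≡e      = adjE u pu≡e

    spareColouring : SpareColouring G ℓ
    spareColouring with any? (λ m → ¬? (q m ≟ b))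
    ... | yes (x , qx≢b) = record
      { colour = h ; proper = proper-h ; missing = a ; missing∉ = a∉h
      ; spare = q x ; missing≢spare = q≢a x ∘ ≡.sym ; redundant = redundant }
      where
      redundant : Redundant G h (q x)
      redundant v with dominating (shadow v)
      ... | e , dom with e ≟ a
      ...   | yes refl = b , qx≢b ∘ ≡.sym , occurs-b , dominates-b (λ u → dom (orig u))
      ...   | no e≢a = e , (λ e≡qx → noShadow x (≡.sym e≡qx)) , shadowFree e≢a noShadow (λ u → dom (orig u))
        where
        noShadow : ∀ m → q m ≢ e
        noShadow m = dom (shadow m)
    ... | no ¬shadowOutsideB = record
      { colour = h ; proper = proper-h ; missing = a ; missing∉ = a∉h
      ; spare = b ; missing≢spare = a≢b ; redundant = redundant }
      where
      all-b : ∀ m → q m ≡ b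
      all-b m with q m ≟ b
      ... | yes qm≡b = qm≡b
      ... | no qm≢b  = ⊥-elim (¬shadowOutsideB (m , qm≢b))

      redundant : Redundant G h b
      redundant v with dominating (orig v)
      ... | f , dom = f , f≢b , shadowFree (dom root ∘ ≡.sym) noShadow (λ u → dom (orig u))
        where
        noShadow : ∀ m → q m ≢ f
        noShadow m qm≡f = irrefl G (dom (shadow v) (trans (all-b v) (trans (≡.sym (all-b m)) qm≡f)))

        f≢b : f ≢ b
        f≢b f≡b = noShadow v (trans (all-b v) (≡.sym f≡b))

  module NoOriginalColouredA (p≢a : ∀ m → p m ≢ a) where

    Pure : Fin ℓ → Set
    Pure c = ∀ m → p m ≢ c

    IsRep : Fin n → Set
    IsRep l = Pure (q l) × (∀ m → q m ≡ q l → l Fin.≤ m)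

    isRep? : ∀ l → Dec (IsRep l)
    isRep? l = all? (λ m → ¬? (p m ≟ q l)) ×-dec all? (λ m → (q m ≟ q l) →-dec (l Fin.≤? m))

    rep-unique : ∀ {j l} → IsRep j → IsRep l → q j ≡ q l → j ≡ l
    rep-unique (_ , j≤) (_ , l≤) qj≡ql = ≤-antisym (j≤ _ (≡.sym qj≡ql)) (l≤ _ qj≡ql)

    rep-exists : ∀ {c} → Pure c → ∃[ m ] q m ≡ c → ∃[ r ] IsRep r × q r ≡ c
    rep-exists pure shadow-c with least (λ m → q m ≟ _) shadow-c
    ... | r , refl , r≤ = r , (pure , r≤) , refl

    h : Fin n → Fin ℓ
    h l = if does (isRep? l) then q l else p l

    h-cases : ∀ l → (IsRep l × h l ≡ q l) ⊎ (¬ IsRep l × h l ≡ p l)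
    h-cases l = if-dec-cases (isRep? l) (q l) (p l)

    a∉h : ∀ u → a ≢ h u
    a∉h u a≡hu with h-cases u
    ... | inj₁ (_ , hu≡qu) = q≢a u (≡.sym (trans a≡hu hu≡qu))
    ... | inj₂ (_ , hu≡pu) = p≢a u (≡.sym (trans a≡hu hu≡pu))

    proper-h : Proper G h
    proper-h u v adj hu≡hv with h-cases u | h-cases v
    ... | inj₁ (ru , hu≡qu) | inj₁ (rv , hv≡qv) =
      irrefl G (subst (Adj G u) (≡.sym (rep-unique ru rv (trans (≡.sym hu≡qu) (trans hu≡hv hv≡qv)))) adj)
    ... | inj₁ (_ , hu≡qu) | inj₂ (_ , hv≡pv) =
      proper (shadow u) (orig v) adj (trans (≡.sym hu≡qu) (trans hu≡hv hv≡pv))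
    ... | inj₂ (_ , hu≡pu) | inj₁ (_ , hv≡qv) =
      proper (orig u) (shadow v) adj (trans (≡.sym hu≡pu) (trans hu≡hv hv≡qv))
    ... | inj₂ (_ , hu≡pu) | inj₂ (_ , hv≡pv) =
      proper (orig u) (orig v) adj (trans (≡.sym hu≡pu) (trans hu≡hv hv≡pv))

    dominates-orig : ∀ {v f} → Dominates (Mycielskian G) g (orig v) f → Dominates G h v f
    dominates-orig dom u hu≡f with h-cases u
    ... | inj₁ (_ , hu≡qu) = dom (shadow u) (trans (≡.sym hu≡qu) hu≡f)
    ... | inj₂ (_ , hu≡pu) = dom (orig u) (trans (≡.sym hu≡pu) hu≡f)

    occurs-rep : ∀ {r} → IsRep r → Occurs h (q r)
    occurs-rep {r} isRep with h-cases r
    ... | inj₁ (_ , hr≡qr) = r , hr≡qr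
    ... | inj₂ (¬isRep , _) = ⊥-elim (¬isRep isRep)

    dominates-rep : ∀ {v r} → IsRep r → Adj G v r → Dominates G h v (q r)
    dominates-rep {v} isRep adj u hu≡qr with h-cases u
    ... | inj₁ (isRep′ , hu≡qu) = subst (Adj G v) (rep-unique isRep isRep′ (trans (≡.sym hu≡qr) hu≡qu)) adj
    ... | inj₂ (_ , hu≡pu)       = ⊥-elim (proj₁ isRep u (trans (≡.sym hu≡pu) hu≡qr))

    b-rep : ∃[ r ] IsRep r × q r ≡ b
    b-rep = rep-exists p≢b b-shadow

    r-b : Fin n
    r-b = proj₁ b-rep

    viaRep : ∀ {v r} → IsRep r → Adj G v r → ∃[ d ] d ≢ p r-b × Occurs h d × Dominates G h v d
    viaRep isRep adj = _ , proj₁ isRep r-b ∘ ≡.sym , occurs-rep isRep , dominates-rep isRep adj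

    redundant : Redundant G h (p r-b)
    redundant v with dominating (orig v)
    ... | f , dom with any? (λ m → p m ≟ f)
    ...   | no ¬original with classMember f (dom root ∘ ≡.sym)
    ...     | inj₁ original = ⊥-elim (¬original original)
    ...     | inj₂ shadow-f with rep-exists (λ m pm≡f → ¬original (m , pm≡f)) shadow-f
    ...       | r , isRep , refl = viaRep isRep (dom (shadow r) refl)
    redundant v | f , dom | yes (m , pm≡f) with f ≟ p r-b
    ... | yes refl = viaRep (proj₁ (proj₂ b-rep)) (dom (orig r-b) refl)
    ... | no f≢spare with any? (λ u → ¬? (isRep? u) ×-dec (p u ≟ f))
    ...   | yes (u , ¬isRep , pu≡f) = f , f≢spare , occurs-f , dominates-orig dom
      where
      occurs-f : Occurs h f
      occurs-f with h-cases u
      ... | inj₁ (isRep , _)  = ⊥-elim (¬isRep isRep)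
      ... | inj₂ (_ , hu≡pu) = u , trans hu≡pu pu≡f
    ...   | no ¬nonRep with isRep? m
    ...     | yes isRep = viaRep isRep (dom (orig m) pm≡f)
    ...     | no ¬isRep = ⊥-elim (¬nonRep (m , ¬isRep , pm≡f))

    spareColouring : SpareColouring G ℓ
    spareColouring = record
      { colour = h ; proper = proper-h ; missing = a ; missing∉ = a∉h
      ; spare = p r-b ; missing≢spare = p≢a r-b ∘ ≡.sym ; redundant = redundant }

  spareColouring : SpareColouring G ℓ
  spareColouring with any? (λ l → p l ≟ a)
  ... | yes (l₀ , pl₀≡a) = SomeOriginalColouredA.spareColouring l₀ pl₀≡a
  ... | no none          = NoOriginalColouredA.spareColouring (λ l pl≡a → none (l , pl≡a))

theorem2p4 : (n : ℕ) (G : FinGraph n) → MinDegAtLeast1 G →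
    (k k′ : ℕ) → IsTDCNumber G k → IsTDCNumber (Mycielskian G) k′ →
    (Class2 G ⇔ (k′ ≡ k + 2))
theorem2p4 n G _ k k′ χ@((f , tdc) , minimal) ((g , tdc′) , minimal′) = mk⇔ class2⇒ ⇒class2
  where
  open FromMycielskianTDC G g tdc′ using (spareColouring; vertex)

  k+2≡ : k + 2 ≡ suc (suc k)
  k+2≡ = +-comm k 2

  lower : suc k ℕ.≤ k′
  lower with spareColouring⇒smallerTDC spareColouring
  ... | m , m<k′ , tdcₘ = ≤-trans (s≤s (minimal m tdcₘ)) m<k′

  upper : k′ ℕ.≤ suc (suc k)
  upper = minimal′ _ (TDC⇒mycielskianTDC tdc vertex)

  class2⇒ : Class2 G → k′ ≡ k + 2
  class2⇒ class2 with k′ ℕ.≟ suc (suc k)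
  ... | yes k′≡k+2 = trans k′≡k+2 (≡.sym k+2≡)
  ... | no k′≢k+2 =
    ⊥-elim (class2 (spareColouring⇒Class1 χ (subst (SpareColouring G) k′≡k+1 spareColouring)))
    where
    k′≡k+1 : k′ ≡ suc k
    k′≡k+1 = ℕ.≤-antisym (≤-pred (≤∧≢⇒< upper k′≢k+2)) lower

  ⇒class2 : k′ ≡ k + 2 → Class2 G
  ⇒class2 k′≡k+2 (k₁ , (_ , minimal₁) , f₁ , tdc₁ , i , noPN) =
    <⇒≱ (ℕ.≤-reflexive (≡.sym (trans k′≡k+2 k+2≡))) k′≤k+1
    where
    k′≤k₁+1 : k′ ℕ.≤ suc k₁
    k′≤k₁+1 = minimal′ _ (redundantTDC⇒mycielskianTDC {G = G} tdc₁
                             (noPrivNbr⇒redundant {G = G} {c = i} tdc₁ noPN))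

    k′≤k+1 : k′ ℕ.≤ suc k
    k′≤k+1 = ≤-trans k′≤k₁+1 (s≤s (minimal₁ k (f , tdc)))
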